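{- Let $n\ge1$. For the graph $\Phi(\mathbb H(\mathbb Z_{2^n}))$: (i) the minimum degree is $2^{4n-1}-1$ if $n=1$ and $2^{4n-1}-2$ if $n>1$; (ii) the maximum degree is $2^{4n}-3$ if $n=1$ and $2^{4n}-4$ if $n>1$; (iii) the girth is $3$.
   Context: $\mathbb H(\mathbb Z_{2^n})$ is the ring of Hamilton quaternions over $\mathbb Z_{2^n}$. Its elements are $a_1+a_2i+a_3j+a_4k$ with $a_i\in\mathbb Z_{2^n}$, written $(a_1,a_2,a_3,a_4)$. Addition is coordinatewise, and multiplication is determined by distributivity, scalars commuting with $i,j,k$, and $i^2=j^2=k^2=-1$, $ij=-ji=k$, $jk=-kj=i$, $ki=-ik=j$. For a ring $R$ with unity, the non-zero divisor graph $\Phi(R)$ is the simple graph with vertex set $R\setminus\{0,1,-1\}$ in which two distinct vertices $x,y$ are adjacent if and only if $xy\neq0$ or $yx\neq0$. -}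

module Defs where

open import Data.Nat using (ℕ; zero; suc; _+_; _*_; _∸_; _^_; _≤_; _<_; NonZero)
open import Data.Nat.Properties using (m^n≢0)
open import Data.Nat.DivMod using (_mod_)
open import Data.Fin using (Fin; toℕ)
open import Data.Fin.Properties as FinP using ()
open import Data.Product using (Σ; ∃; _×_; _,_)
open import Data.List using (List; []; _∷_; length; filter; map; concatMap)
open import Data.List.Membership.Propositional using (_∈_)
open import Relation.Nullary using (¬_; Dec; yes; no)
open import Relation.Nullary.Decidable using (_×-dec_; ¬?; _⊎-dec_)
open import Data.Sum using (_⊎_)
open import Relation.Binary.PropositionalEquality using (_≡_; _≢_)
open import Data.Fin using (_≟_)

M : ℕ → ℕ
M n = 2 ^ n

M-nonZero : ∀ n → NonZero (M n)
M-nonZero n = m^n≢0 2 n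

modM : ∀ n → ℕ → Fin (M n)
modM n a = _mod_ a (M n) {{M-nonZero n}}

-- wrapped in a record so that n is inferable from the type
record Zmod (n : ℕ) : Set where
  constructor ⟨_⟩
  field
    val : Fin (M n)

open Zmod public

infixl 6 _⊕_ _⊖_
infixl 7 _⊗_

_⊕_ : ∀ {n} → Zmod n → Zmod n → Zmod n
_⊕_ {n} a b = ⟨ modM n (toℕ (val a) + toℕ (val b)) ⟩

_⊗_ : ∀ {n} → Zmod n → Zmod n → Zmod n
_⊗_ {n} a b = ⟨ modM n (toℕ (val a) * toℕ (val b)) ⟩

negZ : ∀ {n} → Zmod n → Zmod n
negZ {n} a = ⟨ modM n (M n ∸ toℕ (val a)) ⟩

_⊖_ : ∀ {n} → Zmod n → Zmod n → Zmod n
a ⊖ b = a ⊕ negZ b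

zeroZ oneZ : ∀ {n} → Zmod n
zeroZ {n} = ⟨ modM n 0 ⟩
oneZ  {n} = ⟨ modM n 1 ⟩

-- Hamilton quaternions H(ℤ_{2^n}): a1 + a2 i + a3 j + a4 k

record H (n : ℕ) : Set where
  constructor quat
  field
    a₁ a₂ a₃ a₄ : Zmod n

open H public

-- Hamilton product (i² = j² = k² = -1, ij = k, jk = i, ki = j)
_·_ : ∀ {n} → H n → H n → H n
quat a1 a2 a3 a4 · quat b1 b2 b3 b4 =
  quat (a1 ⊗ b1 ⊖ a2 ⊗ b2 ⊖ a3 ⊗ b3 ⊖ a4 ⊗ b4)
       (a1 ⊗ b2 ⊕ a2 ⊗ b1 ⊕ a3 ⊗ b4 ⊖ a4 ⊗ b3)
       (a1 ⊗ b3 ⊖ a2 ⊗ b4 ⊕ a3 ⊗ b1 ⊕ a4 ⊗ b2)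
       (a1 ⊗ b4 ⊕ a2 ⊗ b3 ⊖ a3 ⊗ b2 ⊕ a4 ⊗ b1)

0H 1H -1H : ∀ {n} → H n
0H  = quat zeroZ zeroZ zeroZ zeroZ
1H  = quat oneZ zeroZ zeroZ zeroZ
-1H = quat (negZ oneZ) zeroZ zeroZ zeroZ

_≟H_ : ∀ {n} (x y : H n) → Dec (x ≡ y)
quat ⟨ a1 ⟩ ⟨ a2 ⟩ ⟨ a3 ⟩ ⟨ a4 ⟩ ≟H quat ⟨ b1 ⟩ ⟨ b2 ⟩ ⟨ b3 ⟩ ⟨ b4 ⟩
  with a1 ≟ b1 | a2 ≟ b2 | a3 ≟ b3 | a4 ≟ b4
... | yes _≡_.refl | yes _≡_.refl | yes _≡_.refl | yes _≡_.refl = yes _≡_.refl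
... | no p | _ | _ | _ = no λ { _≡_.refl → p _≡_.refl }
... | yes _ | no p | _ | _ = no λ { _≡_.refl → p _≡_.refl }
... | yes _ | yes _ | no p | _ = no λ { _≡_.refl → p _≡_.refl }
... | yes _ | yes _ | yes _ | no p = no λ { _≡_.refl → p _≡_.refl }

IsVertex : ∀ {n} → H n → Set
IsVertex x = x ≢ 0H × x ≢ 1H × x ≢ -1H

isVertex? : ∀ {n} (x : H n) → Dec (IsVertex x)
isVertex? x = ¬? (x ≟H 0H) ×-dec ¬? (x ≟H 1H) ×-dec ¬? (x ≟H -1H)

Adj : ∀ {n} → H n → H n → Set
Adj x y = IsVertex x × IsVertex y × x ≢ y × ((x · y ≢ 0H) ⊎ (y · x ≢ 0H))

adj? : ∀ {n} (x y : H n) → Dec (Adj x y)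
adj? x y = isVertex? x ×-dec isVertex? y ×-dec ¬? (x ≟H y)
           ×-dec (¬? ((x · y) ≟H 0H) ⊎-dec ¬? ((y · x) ≟H 0H))

allZ : ∀ n → List (Zmod n)
allZ n = map ⟨_⟩ (Data.List.allFin (M n))

allH : ∀ n → List (H n)
allH n = concatMap (λ a → concatMap (λ b → concatMap (λ c → map (λ d → quat a b c d)
           (allZ n)) (allZ n)) (allZ n)) (allZ n)

deg : ∀ {n} → H n → ℕ
deg {n} x = length (filter (adj? x) (allH n))

IsMinDegree : ℕ → ℕ → Set
IsMinDegree n d = (Σ (H n) λ x → IsVertex x × deg x ≡ d)
                × (∀ (x : H n) → IsVertex x → d ≤ deg x)

IsMaxDegree : ℕ → ℕ → Set
IsMaxDegree n d = (Σ (H n) λ x → IsVertex x × deg x ≡ d)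
                × (∀ (x : H n) → IsVertex x → deg x ≤ d)

-- girth 3: in a simple graph every cycle has length ≥ 3, so the girth
-- equals 3 exactly when a 3-cycle (triangle) exists.
Girth3 : ℕ → Set
Girth3 n = Σ (H n) λ x → Σ (H n) λ y → Σ (H n) λ z → Adj x y × Adj y z × Adj z x

-- For x ≠ 0, translation y ↦ y + 1 maps the two-sided annihilator Ann(x) = {y ∣ xy = yx = 0}
-- injectively into its complement, since x(y + 1) = xy + x; as |H| = 2·2^(4n−1), the complement
-- has at least K = 2^(4n−1) elements. The neighbours of a vertex x are exactly the elements of the
-- complement other than ±1 and x, so deg x ≥ K − 2 when x² = 0. When x² ≠ 0 and n ≥ 2, the element
-- 2 = 1 + 1 is a further non-annihilator outside the image of the translation (2x = 0 would force
-- x² = 0, all coordinates of x being multiples of 2ⁿ⁻¹), which gains the one vertex lost to x itself.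
-- The bound is attained at x₀ = 2ⁿ⁻¹(1 + i + j + k): it annihilates every quaternion of even coordinate
-- sum, so the translation maps the complement of Ann(x₀) back into Ann(x₀). Every vertex misses
-- 0, ±1 and itself, and the unit i misses nothing else. The units i, j, k form a triangle, and the
-- case n = 1 is a finite computation.
module Submission where

open import Defs
open import Algebra.Bundles using (CommutativeRing)
open import Algebra.Structures using (IsCommutativeRing)
import Algebra.Properties.Ring as RingProperties
import Algebra.Properties.CommutativeSemigroup as CommutativeSemigroupProperties
import Algebra.Solver.CommutativeMonoid as CommutativeMonoidSolver
open import Data.Fin using (toℕ)
open import Data.Fin.Properties using (toℕ-injective; toℕ-fromℕ<; toℕ<n)
open import Data.List using (List; []; _∷_; length; filter; map; _++_; concatMap; allFin)
open import Data.List.Properties using (length-++; length-map; length-tabulate; filter-notAll)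
open import Data.List.Membership.Propositional using (_∈_; find; lose)
open import Data.List.Membership.Propositional.Properties
  using (∈-filter⁺; ∈-filter⁻; ∈-map⁺; ∈-map⁻; ∈-++⁺ˡ; ∈-++⁺ʳ; ∈-++⁻; ∈-concatMap⁺; ∈-concatMap⁻; ∈-allFin)
open import Data.List.Relation.Binary.Subset.Propositional using (_⊆_)
open import Data.List.Relation.Unary.All as All using (All; []; _∷_; all?)
import Data.List.Relation.Unary.All.Properties as AllP
open import Data.List.Relation.Unary.AllPairs using ([]; _∷_)
open import Data.List.Relation.Unary.Any as Any using (Any; here; there)
open import Data.List.Relation.Unary.Unique.Propositional using (Unique)
import Data.List.Relation.Unary.Unique.Propositional.Properties as Unique
open import Data.Nat using (ℕ; zero; suc; _+_; _*_; _∸_; _^_; _≤_; _<_; _≤?_; _%_; NonZero; z≤n; s≤s; s≤s⁻¹; z<s)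
open import Data.Nat.DivMod using (%-distribˡ-+; %-distribˡ-*; m<n⇒m%n≡m)
open import Data.Nat.Divisibility
  using (_∣_; ∣-refl; ∣-trans; m∣m*n; *-pres-∣; *-cancelˡ-∣; m%n≡0⇒n∣m; n∣m⇒m%n≡0)
open import Data.Nat.Properties
  using ( module ≤-Reasoning; +-suc; +-assoc; +-comm; +-identityʳ; *-assoc; *-comm; *-identityˡ; *-identityʳ
        ; *-distribˡ-+; ^-*-assoc; ^-monoʳ-<; m^n>0; m+[n∸m]≡n; m<m+n; n<1+n; m≤n+o⇒m∸n≤o; m+n≤o⇒m≤o∸n
        ; ≤-trans; ≤-antisym; <⇒≤; <⇒≢; ≮⇒≥; ≰⇒>; ≤-<-trans; <-≤-trans; +-mono-<; +-mono-<-≤; +-monoʳ-≤)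
open import Data.Product using (∃; _×_; _,_; proj₁; proj₂)
open import Data.Sign using (Sign) renaming (+ to ⁺; - to ⁻)
open import Data.Sum using (_⊎_; inj₁; inj₂; [_,_]′)
open import Function using (_∘_)
open import Level using (0ℓ)
open import Relation.Binary.Definitions using (DecidableEquality)
open import Relation.Binary.PropositionalEquality
open import Relation.Nullary using (¬_; Dec; yes; no; contradiction)
open import Relation.Nullary.Decidable using (¬?; _×-dec_; _→-dec_; toWitness; toSum; decidable-stable)
open import Relation.Unary using (Pred; Decidable)

m+n≡o+o∧m≤n⇒o≤n : ∀ {m n o} → m + n ≡ o + o → m ≤ n → o ≤ n
m+n≡o+o∧m≤n⇒o≤n e m≤n = ≮⇒≥ λ n<o → <⇒≢ (+-mono-< (≤-<-trans m≤n n<o) n<o) e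

m+n≡o+o∧m<n⇒o<n : ∀ {m n o} → m + n ≡ o + o → m < n → o < n
m+n≡o+o∧m<n⇒o<n e m<n = ≰⇒> λ n≤o → <⇒≢ (+-mono-<-≤ (<-≤-trans m<n n≤o) n≤o) e

m+n≡o+o∧n≤m⇒n≤o : ∀ {m n o} → m + n ≡ o + o → n ≤ m → n ≤ o
m+n≡o+o∧n≤m⇒n≤o e n≤m = ≮⇒≥ λ o<n → <⇒≢ (+-mono-< (<-≤-trans o<n n≤m) o<n) (sym e)

ℕ-even⊎odd : ∀ k → (∃ λ q → k ≡ q + q) ⊎ (∃ λ q → k ≡ q + q + 1)
ℕ-even⊎odd zero = inj₁ (0 , refl)
ℕ-even⊎odd (suc zero) = inj₂ (0 , refl)
ℕ-even⊎odd (suc (suc k)) with ℕ-even⊎odd k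
... | inj₁ (q , refl) = inj₁ (suc q , cong suc (sym (+-suc q q)))
... | inj₂ (q , refl) = inj₂ (suc q , cong suc (cong (_+ 1) (sym (+-suc q q))))

module _ {A : Set} where

  length-filter-complement : {P : Pred A 0ℓ} (P? : Decidable P) (xs : List A) →
    length (filter P? xs) + length (filter (¬? ∘ P?) xs) ≡ length xs
  length-filter-complement P? [] = refl
  length-filter-complement P? (x ∷ xs) with P? x
  ... | yes _ = cong suc (length-filter-complement P? xs)
  ... | no _  = trans (+-suc _ _) (cong suc (length-filter-complement P? xs))

  unique-⊆⇒length-≤ : DecidableEquality A → {xs ys : List A} → Unique xs → xs ⊆ ys → length xs ≤ length ys
  unique-⊆⇒length-≤ _≟_ {[]} _ _ = z≤n
  unique-⊆⇒length-≤ _≟_ {x ∷ xs} {ys} (x∉xs ∷ xs!) xs⊆ys =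
    ≤-trans (s≤s (unique-⊆⇒length-≤ _≟_ xs! xs⊆ys-x)) (filter-notAll ≢x? ys x∈ys)
    where
    ≢x? : Decidable (λ y → ¬ y ≡ x)
    ≢x? y = ¬? (y ≟ x)
    xs⊆ys-x : xs ⊆ filter ≢x? ys
    xs⊆ys-x y∈xs = ∈-filter⁺ ≢x? (xs⊆ys (there y∈xs)) (λ y≡x → All.lookup x∉xs y∈xs (sym y≡x))
    x∈ys : Any (λ y → ¬ ¬ y ≡ x) ys
    x∈ys = Any.map (λ x≡y y≢x → y≢x (sym x≡y)) (xs⊆ys (here refl))

module _ {A B : Set} {f : A → List B} where

  length-concatMap : ∀ {m} → (∀ a → length (f a) ≡ m) → ∀ xs → length (concatMap f xs) ≡ length xs * m
  length-concatMap f-length [] = refl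
  length-concatMap f-length (x ∷ xs) =
    trans (length-++ (f x)) (cong₂ _+_ (f-length x) (length-concatMap f-length xs))

  All-concatMap : {P : Pred B 0ℓ} → (∀ a → All P (f a)) → ∀ xs → All P (concatMap f xs)
  All-concatMap f-all xs = AllP.concat⁺ (AllP.map⁺ (All.universal f-all xs))

  unique-concatMap : (p : B → A) → (∀ a → All (λ y → p y ≡ a) (f a)) → (∀ a → Unique (f a)) →
    ∀ {xs} → Unique xs → Unique (concatMap f xs)
  unique-concatMap p f-fibre f! {[]} [] = []
  unique-concatMap p f-fibre f! {x ∷ xs} (x∉xs ∷ xs!) =
    Unique.++⁺ (f! x) (unique-concatMap p f-fibre f! xs!) disjoint
    where
    disjoint : ∀ {y} → ¬ (y ∈ f x × y ∈ concatMap f xs)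
    disjoint (y∈fx , y∈fxs) with find (∈-concatMap⁻ f {xs = xs} y∈fxs)
    ... | a , a∈xs , y∈fa =
      All.lookup x∉xs a∈xs (trans (sym (All.lookup (f-fibre x) y∈fx)) (All.lookup (f-fibre a) y∈fa))

module Counting {A : Set} (_≟_ : DecidableEquality A)
                (enum : List A) (enum! : Unique enum) (∈enum : ∀ x → x ∈ enum) where

  count : {P : Pred A 0ℓ} → Decidable P → ℕ
  count P? = length (filter P? enum)

  private
    filter! : {P : Pred A 0ℓ} (P? : Decidable P) → Unique (filter P? enum)
    filter! P? = Unique.filter⁺ P? {xs = enum} enum!

    ∈filter⇒ : {P : Pred A 0ℓ} (P? : Decidable P) {y : A} → y ∈ filter P? enum → P y
    ∈filter⇒ P? = proj₂ ∘ ∈-filter⁻ P? {xs = enum}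

  count-complement : {P : Pred A 0ℓ} (P? : Decidable P) → count P? + count (¬? ∘ P?) ≡ length enum
  count-complement P? = length-filter-complement P? enum

  length-≤-count : {P : Pred A 0ℓ} (P? : Decidable P) {ys : List A} →
    Unique ys → (∀ {y} → y ∈ ys → P y) → length ys ≤ count P?
  length-≤-count P? ys! ys⊆P = unique-⊆⇒length-≤ _≟_ ys! λ {y} y∈ys → ∈-filter⁺ P? (∈enum y) (ys⊆P y∈ys)

  count-≤-length : {P : Pred A 0ℓ} (P? : Decidable P) {ys : List A} →
    (∀ y → P y → y ∈ ys) → count P? ≤ length ys
  count-≤-length P? P⊆ys = unique-⊆⇒length-≤ _≟_ (filter! P?)
    λ {y} y∈P → P⊆ys y (∈filter⇒ P? y∈P)

  count-≤-injection : {P Q : Pred A 0ℓ} (P? : Decidable P) (Q? : Decidable Q) (f : A → A) →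
    (∀ {x y} → f x ≡ f y → x ≡ y) → (∀ y → P y → Q (f y)) → count P? ≤ count Q?
  count-≤-injection {Q = Q} P? Q? f f-injective f[P]⊆Q = subst (_≤ count Q?) (length-map f (filter P? enum))
    (length-≤-count Q? (Unique.map⁺ f-injective (filter! P?)) f[P]⊆Q′)
    where
    f[P]⊆Q′ : ∀ {y} → y ∈ map f (filter P? enum) → Q y
    f[P]⊆Q′ y∈ with ∈-map⁻ f y∈
    ... | x , x∈P , refl = f[P]⊆Q x (∈filter⇒ P? x∈P)

  count-≤-length+count : {P Q : Pred A 0ℓ} (P? : Decidable P) (Q? : Decidable Q) {ys : List A} →
    (∀ y → P y → y ∈ ys ⊎ Q y) → count P? ≤ length ys + count Q?
  count-≤-length+count P? Q? {ys} P⊆ys∪Q = subst (count P? ≤_) (length-++ ys)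
    (unique-⊆⇒length-≤ _≟_ (filter! P?) λ {y} y∈P →
      [ ∈-++⁺ˡ , (λ Qy → ∈-++⁺ʳ ys (∈-filter⁺ Q? (∈enum y) Qy)) ]′
        (P⊆ys∪Q y (∈filter⇒ P? y∈P)))

  count+length-≤-count : {P Q : Pred A 0ℓ} (P? : Decidable P) (Q? : Decidable Q) {ys : List A} →
    Unique ys → (∀ y → Q y → P y) → (∀ {y} → y ∈ ys → P y × ¬ Q y) → count Q? + length ys ≤ count P?
  count+length-≤-count {P} {Q} P? Q? {ys} ys! Q⊆P ys⊆P∖Q = subst (_≤ count P?) (length-++ (filter Q? enum))
    (length-≤-count P? (Unique.++⁺ (filter! Q?) ys! disjoint) P-on-Q++ys)
    where
    disjoint : ∀ {y} → ¬ (y ∈ filter Q? enum × y ∈ ys)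
    disjoint (y∈Q , y∈ys) = proj₂ (ys⊆P∖Q y∈ys) (∈filter⇒ Q? y∈Q)
    P-on-Q++ys : ∀ {y} → y ∈ filter Q? enum ++ ys → P y
    P-on-Q++ys {y} y∈ = [ (λ y∈Q → Q⊆P y (∈filter⇒ Q? y∈Q)) , (λ y∈ys → proj₁ (ys⊆P∖Q y∈ys)) ]′
      (∈-++⁻ (filter Q? enum) y∈)

module ZmodRing (n : ℕ) where

  private instance
    M-nonZero′ : NonZero (M n)
    M-nonZero′ = M-nonZero n

  ⟦_⟧ : ℕ → Zmod n
  ⟦ k ⟧ = ⟨ modM n k ⟩

  ∣_∣ : Zmod n → ℕ
  ∣ a ∣ = toℕ (val a)

  ∣⟦⟧∣ : ∀ k → ∣ ⟦ k ⟧ ∣ ≡ k % M n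
  ∣⟦⟧∣ k = toℕ-fromℕ< _

  ⟦∣∣⟧ : ∀ a → ⟦ ∣ a ∣ ⟧ ≡ a
  ⟦∣∣⟧ ⟨ v ⟩ = cong ⟨_⟩ (toℕ-injective (trans (∣⟦⟧∣ (toℕ v)) (m<n⇒m%n≡m (toℕ<n v))))

  ⟦⟧-cong-% : ∀ {k l} → k % M n ≡ l % M n → ⟦ k ⟧ ≡ ⟦ l ⟧
  ⟦⟧-cong-% e = cong ⟨_⟩ (toℕ-injective (trans (∣⟦⟧∣ _) (trans e (sym (∣⟦⟧∣ _)))))

  ⟦⟧-+ : ∀ k l → ⟦ k ⟧ ⊕ ⟦ l ⟧ ≡ ⟦ k + l ⟧
  ⟦⟧-+ k l = ⟦⟧-cong-% (begin
    (∣ ⟦ k ⟧ ∣ + ∣ ⟦ l ⟧ ∣) % M n  ≡⟨ cong₂ (λ u v → (u + v) % M n) (∣⟦⟧∣ k) (∣⟦⟧∣ l) ⟩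
    (k % M n + l % M n) % M n      ≡⟨ %-distribˡ-+ k l (M n) ⟨
    (k + l) % M n                  ∎)
    where open ≡-Reasoning

  ⟦⟧-* : ∀ k l → ⟦ k ⟧ ⊗ ⟦ l ⟧ ≡ ⟦ k * l ⟧
  ⟦⟧-* k l = ⟦⟧-cong-% (begin
    (∣ ⟦ k ⟧ ∣ * ∣ ⟦ l ⟧ ∣) % M n  ≡⟨ cong₂ (λ u v → (u * v) % M n) (∣⟦⟧∣ k) (∣⟦⟧∣ l) ⟩
    (k % M n * (l % M n)) % M n    ≡⟨ %-distribˡ-* k l (M n) ⟨
    (k * l) % M n                  ∎)
    where open ≡-Reasoning

  0%M≡0 : 0 % M n ≡ 0
  0%M≡0 = m<n⇒m%n≡m (m^n>0 2 n)

  ⟦⟧≡zeroZ⇒M∣ : ∀ {k} → ⟦ k ⟧ ≡ zeroZ → M n ∣ k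
  ⟦⟧≡zeroZ⇒M∣ {k} e = m%n≡0⇒n∣m k (M n) (trans (sym (∣⟦⟧∣ k)) (trans (cong ∣_∣ e) (trans (∣⟦⟧∣ 0) 0%M≡0)))

  M∣⇒⟦⟧≡zeroZ : ∀ {k} → M n ∣ k → ⟦ k ⟧ ≡ zeroZ
  M∣⇒⟦⟧≡zeroZ {k} M∣k = ⟦⟧-cong-% (trans (n∣m⇒m%n≡0 k (M n) M∣k) (sym 0%M≡0))

  ⟦⟧-injective : ∀ {k l} → k < M n → l < M n → ⟦ k ⟧ ≡ ⟦ l ⟧ → k ≡ l
  ⟦⟧-injective {k} {l} k<M l<M e = begin
    k              ≡⟨ m<n⇒m%n≡m k<M ⟨
    k % M n        ≡⟨ ∣⟦⟧∣ k ⟨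
    ∣ ⟦ k ⟧ ∣      ≡⟨ cong ∣_∣ e ⟩
    ∣ ⟦ l ⟧ ∣      ≡⟨ ∣⟦⟧∣ l ⟩
    l % M n        ≡⟨ m<n⇒m%n≡m l<M ⟩
    l              ∎
    where open ≡-Reasoning

  -- The ring laws are transported from ℕ along ⟦_⟧, which preserves + and * and is onto.
  ⊕-assoc : ∀ a b c → (a ⊕ b) ⊕ c ≡ a ⊕ (b ⊕ c)
  ⊕-assoc a b c = begin
    ⟦ ∣ a ∣ + ∣ b ∣ ⟧ ⊕ c           ≡⟨ cong (⟦ ∣ a ∣ + ∣ b ∣ ⟧ ⊕_) (⟦∣∣⟧ c) ⟨
    ⟦ ∣ a ∣ + ∣ b ∣ ⟧ ⊕ ⟦ ∣ c ∣ ⟧   ≡⟨ ⟦⟧-+ _ _ ⟩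
    ⟦ ∣ a ∣ + ∣ b ∣ + ∣ c ∣ ⟧       ≡⟨ cong ⟦_⟧ (+-assoc ∣ a ∣ _ _) ⟩
    ⟦ ∣ a ∣ + (∣ b ∣ + ∣ c ∣) ⟧     ≡⟨ ⟦⟧-+ _ _ ⟨
    ⟦ ∣ a ∣ ⟧ ⊕ (b ⊕ c)             ≡⟨ cong (_⊕ (b ⊕ c)) (⟦∣∣⟧ a) ⟩
    a ⊕ (b ⊕ c)                     ∎
    where open ≡-Reasoning

  ⊗-assoc : ∀ a b c → (a ⊗ b) ⊗ c ≡ a ⊗ (b ⊗ c)
  ⊗-assoc a b c = begin
    ⟦ ∣ a ∣ * ∣ b ∣ ⟧ ⊗ c           ≡⟨ cong (⟦ ∣ a ∣ * ∣ b ∣ ⟧ ⊗_) (⟦∣∣⟧ c) ⟨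
    ⟦ ∣ a ∣ * ∣ b ∣ ⟧ ⊗ ⟦ ∣ c ∣ ⟧   ≡⟨ ⟦⟧-* _ _ ⟩
    ⟦ ∣ a ∣ * ∣ b ∣ * ∣ c ∣ ⟧       ≡⟨ cong ⟦_⟧ (*-assoc ∣ a ∣ _ _) ⟩
    ⟦ ∣ a ∣ * (∣ b ∣ * ∣ c ∣) ⟧     ≡⟨ ⟦⟧-* _ _ ⟨
    ⟦ ∣ a ∣ ⟧ ⊗ (b ⊗ c)             ≡⟨ cong (_⊗ (b ⊗ c)) (⟦∣∣⟧ a) ⟩
    a ⊗ (b ⊗ c)                     ∎
    where open ≡-Reasoning

  ⊗-distribˡ-⊕ : ∀ a b c → a ⊗ (b ⊕ c) ≡ a ⊗ b ⊕ a ⊗ c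
  ⊗-distribˡ-⊕ a b c = begin
    a ⊗ ⟦ ∣ b ∣ + ∣ c ∣ ⟧                ≡⟨ cong (_⊗ ⟦ ∣ b ∣ + ∣ c ∣ ⟧) (⟦∣∣⟧ a) ⟨
    ⟦ ∣ a ∣ ⟧ ⊗ ⟦ ∣ b ∣ + ∣ c ∣ ⟧        ≡⟨ ⟦⟧-* _ _ ⟩
    ⟦ ∣ a ∣ * (∣ b ∣ + ∣ c ∣) ⟧          ≡⟨ cong ⟦_⟧ (*-distribˡ-+ ∣ a ∣ _ _) ⟩
    ⟦ ∣ a ∣ * ∣ b ∣ + ∣ a ∣ * ∣ c ∣ ⟧    ≡⟨ ⟦⟧-+ _ _ ⟨
    a ⊗ b ⊕ a ⊗ c                        ∎
    where open ≡-Reasoning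

  ⊕-identityˡ : ∀ a → zeroZ ⊕ a ≡ a
  ⊕-identityˡ a = begin
    zeroZ ⊕ a            ≡⟨ cong (zeroZ ⊕_) (⟦∣∣⟧ a) ⟨
    ⟦ 0 ⟧ ⊕ ⟦ ∣ a ∣ ⟧    ≡⟨ ⟦⟧-+ 0 _ ⟩
    ⟦ ∣ a ∣ ⟧            ≡⟨ ⟦∣∣⟧ a ⟩
    a                    ∎
    where open ≡-Reasoning

  ⊗-identityˡ : ∀ a → oneZ ⊗ a ≡ a
  ⊗-identityˡ a = begin
    oneZ ⊗ a             ≡⟨ cong (oneZ ⊗_) (⟦∣∣⟧ a) ⟨
    ⟦ 1 ⟧ ⊗ ⟦ ∣ a ∣ ⟧    ≡⟨ ⟦⟧-* 1 _ ⟩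
    ⟦ 1 * ∣ a ∣ ⟧        ≡⟨ cong ⟦_⟧ (*-identityˡ ∣ a ∣) ⟩
    ⟦ ∣ a ∣ ⟧            ≡⟨ ⟦∣∣⟧ a ⟩
    a                    ∎
    where open ≡-Reasoning

  ⊕-inverseʳ : ∀ a → a ⊕ negZ a ≡ zeroZ
  ⊕-inverseʳ a = begin
    a ⊕ negZ a                        ≡⟨ cong (_⊕ negZ a) (⟦∣∣⟧ a) ⟨
    ⟦ ∣ a ∣ ⟧ ⊕ ⟦ M n ∸ ∣ a ∣ ⟧       ≡⟨ ⟦⟧-+ _ _ ⟩
    ⟦ ∣ a ∣ + (M n ∸ ∣ a ∣) ⟧         ≡⟨ cong ⟦_⟧ (m+[n∸m]≡n (<⇒≤ (toℕ<n (val a)))) ⟩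
    ⟦ M n ⟧                           ≡⟨ M∣⇒⟦⟧≡zeroZ ∣-refl ⟩
    zeroZ                             ∎
    where open ≡-Reasoning

  ⊕-comm : ∀ a b → a ⊕ b ≡ b ⊕ a
  ⊕-comm a b = cong ⟦_⟧ (+-comm ∣ a ∣ ∣ b ∣)

  ⊗-comm : ∀ a b → a ⊗ b ≡ b ⊗ a
  ⊗-comm a b = cong ⟦_⟧ (*-comm ∣ a ∣ ∣ b ∣)

  isCommutativeRing : IsCommutativeRing _≡_ _⊕_ _⊗_ negZ zeroZ oneZ
  isCommutativeRing = record
    { isRing = record
      { +-isAbelianGroup = record
        { isGroup = record
          { isMonoid = record
            { isSemigroup = record
              { isMagma = record { isEquivalence = isEquivalence ; ∙-cong = cong₂ _⊕_ }
              ; assoc = ⊕-assoc }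
            ; identity = ⊕-identityˡ , λ a → trans (⊕-comm a zeroZ) (⊕-identityˡ a) }
          ; inverse = (λ a → trans (⊕-comm (negZ a) a) (⊕-inverseʳ a)) , ⊕-inverseʳ
          ; ⁻¹-cong = cong negZ }
        ; comm = ⊕-comm }
      ; *-cong = cong₂ _⊗_
      ; *-assoc = ⊗-assoc
      ; *-identity = ⊗-identityˡ , λ a → trans (⊗-comm a oneZ) (⊗-identityˡ a)
      ; distrib = ⊗-distribˡ-⊕ , λ a b c → trans (⊗-comm (b ⊕ c) a)
                    (trans (⊗-distribˡ-⊕ a b c) (cong₂ _⊕_ (⊗-comm a b) (⊗-comm a c))) }
    ; *-comm = ⊗-comm }

  commutativeRing : CommutativeRing 0ℓ 0ℓ
  commutativeRing = record { isCommutativeRing = isCommutativeRing }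

  even⊎odd : ∀ a → (∃ λ t → a ≡ t ⊕ t) ⊎ (∃ λ t → a ≡ t ⊕ t ⊕ oneZ)
  even⊎odd a with ℕ-even⊎odd ∣ a ∣
  ... | inj₁ (q , ∣a∣≡q+q) = inj₁ (⟦ q ⟧ , (begin
    a                  ≡⟨ ⟦∣∣⟧ a ⟨
    ⟦ ∣ a ∣ ⟧          ≡⟨ cong ⟦_⟧ ∣a∣≡q+q ⟩
    ⟦ q + q ⟧          ≡⟨ ⟦⟧-+ q q ⟨
    ⟦ q ⟧ ⊕ ⟦ q ⟧      ∎))
    where open ≡-Reasoning
  ... | inj₂ (q , ∣a∣≡q+q+1) = inj₂ (⟦ q ⟧ , (begin
    a                       ≡⟨ ⟦∣∣⟧ a ⟨
    ⟦ ∣ a ∣ ⟧               ≡⟨ cong ⟦_⟧ ∣a∣≡q+q+1 ⟩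
    ⟦ q + q + 1 ⟧           ≡⟨ ⟦⟧-+ (q + q) 1 ⟨
    ⟦ q + q ⟧ ⊕ oneZ        ≡⟨ cong (_⊕ oneZ) (⟦⟧-+ q q) ⟨
    ⟦ q ⟧ ⊕ ⟦ q ⟧ ⊕ oneZ    ∎))
    where open ≡-Reasoning

1<2 : 1 < 2
1<2 = s≤s (s≤s z≤n)

oneZ≢zeroZ : ∀ m → ¬ oneZ {suc m} ≡ zeroZ
oneZ≢zeroZ m e = 1≢0 (⟦⟧-injective (^-monoʳ-< 2 1<2 {0} {suc m} z<s) (m^n>0 2 (suc m)) e)
  where
  open ZmodRing (suc m)
  1≢0 : ¬ 1 ≡ 0
  1≢0 ()

two≢zeroZ : ∀ k → ¬ oneZ {2 + k} ⊕ oneZ ≡ zeroZ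
two≢zeroZ k e = 2≢0 (⟦⟧-injective (^-monoʳ-< 2 1<2 {1} {2 + k} (s≤s (s≤s z≤n))) (m^n>0 2 (2 + k))
                   (trans (sym (⟦⟧-+ 1 1)) e))
  where
  open ZmodRing (2 + k)
  2≢0 : ¬ 2 ≡ 0
  2≢0 ()

half : ∀ m → Zmod (suc m)
half m = ZmodRing.⟦_⟧ (suc m) (2 ^ m)

half⊕half≡zeroZ : ∀ m → half m ⊕ half m ≡ zeroZ
half⊕half≡zeroZ m = begin
  ⟦ 2 ^ m ⟧ ⊕ ⟦ 2 ^ m ⟧    ≡⟨ ⟦⟧-+ (2 ^ m) (2 ^ m) ⟩
  ⟦ 2 ^ m + 2 ^ m ⟧        ≡⟨ cong (λ t → ⟦ 2 ^ m + t ⟧) (+-identityʳ (2 ^ m)) ⟨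
  ⟦ 2 ^ suc m ⟧            ≡⟨ M∣⇒⟦⟧≡zeroZ ∣-refl ⟩
  zeroZ                    ∎
  where
  open ZmodRing (suc m)
  open ≡-Reasoning

half≢zeroZ : ∀ m → ¬ half m ≡ zeroZ
half≢zeroZ m e = <⇒≢ (m^n>0 2 m) (sym (⟦⟧-injective (^-monoʳ-< 2 1<2 (n<1+n m)) (m^n>0 2 (suc m)) e))
  where open ZmodRing (suc m)

⊕-self≡zeroZ⇒⊗≡zeroZ : ∀ k (a b : Zmod (2 + k)) → a ⊕ a ≡ zeroZ → b ⊕ b ≡ zeroZ → a ⊗ b ≡ zeroZ
⊕-self≡zeroZ⇒⊗≡zeroZ k a b a+a≡0 b+b≡0 =
  M∣⇒⟦⟧≡zeroZ (∣-trans 2²⁺ᵏ∣2¹⁺ᵏ2¹⁺ᵏ (*-pres-∣ (2¹⁺ᵏ∣ {a} a+a≡0) (2¹⁺ᵏ∣ {b} b+b≡0)))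
  where
  open ZmodRing (2 + k)
  2¹⁺ᵏ∣ : ∀ {c} → c ⊕ c ≡ zeroZ → 2 ^ (1 + k) ∣ ∣ c ∣
  2¹⁺ᵏ∣ {c} c+c≡0 = *-cancelˡ-∣ 2 (subst (2 ^ (2 + k) ∣_) (cong (∣ c ∣ +_) (sym (+-identityʳ ∣ c ∣)))
                     (⟦⟧≡zeroZ⇒M∣ c+c≡0))
  2²⁺ᵏ∣2¹⁺ᵏ2¹⁺ᵏ : 2 ^ (2 + k) ∣ 2 ^ (1 + k) * 2 ^ (1 + k)
  2²⁺ᵏ∣2¹⁺ᵏ2¹⁺ᵏ = *-pres-∣ (m∣m*n {2} (2 ^ k)) (∣-refl {2 ^ (1 + k)})

module Enumeration (n : ℕ) where

  allZ! : Unique (allZ n)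
  allZ! = Unique.map⁺ (cong val) (Unique.allFin⁺ (M n))

  ∈allZ : ∀ a → a ∈ allZ n
  ∈allZ ⟨ v ⟩ = ∈-map⁺ ⟨_⟩ (∈-allFin v)

  length-allZ : length (allZ n) ≡ 2 ^ n
  length-allZ = trans (length-map (⟨_⟩ {n}) (allFin (M n))) (length-tabulate {n = M n} (λ i → i))

  line : Zmod n → Zmod n → Zmod n → List (H n)
  line a b c = map (quat a b c) (allZ n)

  plane : Zmod n → Zmod n → List (H n)
  plane a b = concatMap (line a b) (allZ n)

  space : Zmod n → List (H n)
  space a = concatMap (plane a) (allZ n)

  line-fibre : ∀ {P : H n → Set} {a b c} → (∀ {d} → P (quat a b c d)) → All P (line a b c)
  line-fibre P-quat = AllP.map⁺ (All.universal (λ _ → P-quat) (allZ n))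

  plane-fibre : ∀ {P : H n → Set} {a b} → (∀ {c d} → P (quat a b c d)) → All P (plane a b)
  plane-fibre P-quat = All-concatMap (λ _ → line-fibre P-quat) (allZ n)

  allH! : Unique (allH n)
  allH! = unique-concatMap {f = space} a₁ (λ _ → All-concatMap (λ _ → plane-fibre refl) (allZ n))
    (λ a → unique-concatMap {f = plane a} a₂ (λ _ → plane-fibre refl)
      (λ b → unique-concatMap {f = line a b} a₃ (λ _ → line-fibre refl)
        (λ c → Unique.map⁺ (cong a₄) allZ!) allZ!) allZ!) allZ!

  ∈allH : ∀ x → x ∈ allH n
  ∈allH (quat a b c d) = ∈-concatMap⁺ space (lose (∈allZ a) (∈-concatMap⁺ (plane a) (lose (∈allZ b)
    (∈-concatMap⁺ (line a b) (lose (∈allZ c) (∈-map⁺ (quat a b c) (∈allZ d)))))))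

  length-allH : length (allH n) ≡ 2 ^ (4 * n)
  length-allH = begin
    length (allH n)         ≡⟨ length-concatMap length-space (allZ n) ⟩
    length (allZ n) * N³    ≡⟨ cong (_* N³) length-allZ ⟩
    N * N³                  ≡⟨ cong (λ t → N * (N * (N * t))) (*-identityʳ N) ⟨
    (2 ^ n) ^ 4             ≡⟨ ^-*-assoc 2 n 4 ⟩
    2 ^ (n * 4)             ≡⟨ cong (2 ^_) (*-comm n 4) ⟩
    2 ^ (4 * n)             ∎
    where
    open ≡-Reasoning
    N = 2 ^ n
    N³ = N * (N * N)
    length-line : ∀ {a b c} → length (line a b c) ≡ N
    length-line {a} {b} {c} = trans (length-map (quat a b c) (allZ n)) length-allZ
    length-plane : ∀ {a b} → length (plane a b) ≡ N * N
    length-plane = trans (length-concatMap (λ _ → length-line) (allZ n)) (cong (_* N) length-allZ)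
    length-space : ∀ a → length (space a) ≡ N³
    length-space _ = trans (length-concatMap (λ _ → length-plane) (allZ n)) (cong (_* (N * N)) length-allZ)

module QuaternionArithmetic (n : ℕ) where

  open ZmodRing n using (commutativeRing)
  private
    module R = CommutativeRing commutativeRing
    module RP = RingProperties R.ring
    module +-Solver = CommutativeMonoidSolver R.+-commutativeMonoid
    open +-Solver using (Expr; _⊜_)

    infixl 6 _⊕′_
    _⊕′_ : ∀ {k} → Expr k → Expr k → Expr k
    _⊕′_ = +-Solver._⊕_

  infixl 6 _⊞_

  _⊞_ : H n → H n → H n
  quat a1 a2 a3 a4 ⊞ quat b1 b2 b3 b4 = quat (a1 ⊕ b1) (a2 ⊕ b2) (a3 ⊕ b3) (a4 ⊕ b4)

  quat-cong : ∀ {a1 a2 a3 a4 b1 b2 b3 b4 : Zmod n} →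
    a1 ≡ b1 → a2 ≡ b2 → a3 ≡ b3 → a4 ≡ b4 → quat a1 a2 a3 a4 ≡ quat b1 b2 b3 b4
  quat-cong refl refl refl refl = refl

  quat≡0H : ∀ {a1 a2 a3 a4 : Zmod n} → quat a1 a2 a3 a4 ≡ 0H →
    a1 ≡ zeroZ × a2 ≡ zeroZ × a3 ≡ zeroZ × a4 ≡ zeroZ
  quat≡0H refl = refl , refl , refl , refl

  Nonreal : H n → Set
  Nonreal x = a₂ x ≢ zeroZ ⊎ a₃ x ≢ zeroZ ⊎ a₄ x ≢ zeroZ

  nonreal⇒vertex : ∀ {x} → Nonreal x → IsVertex x
  nonreal⇒vertex {x} im = real zeroZ , real oneZ , real (negZ oneZ)
    where
    real : ∀ a → x ≢ quat a zeroZ zeroZ zeroZ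
    real a refl = [ (λ 0≢0 → 0≢0 refl) , [ (λ 0≢0 → 0≢0 refl) , (λ 0≢0 → 0≢0 refl) ]′ ]′ im

  ⊞-cancelʳ : ∀ z {x y} → x ⊞ z ≡ y ⊞ z → x ≡ y
  ⊞-cancelʳ (quat c1 c2 c3 c4) {quat a1 a2 a3 a4} {quat b1 b2 b3 b4} e =
    quat-cong (RP.+-cancelʳ c1 a1 b1 (cong a₁ e)) (RP.+-cancelʳ c2 a2 b2 (cong a₂ e))
              (RP.+-cancelʳ c3 a3 b3 (cong a₃ e)) (RP.+-cancelʳ c4 a4 b4 (cong a₄ e))

  -- Coordinate k of x · y is, by definition, signedSum s (a₁ ⊗ b_π₁) (a₂ ⊗ b_π₂) (a₃ ⊗ b_π₃) (a₄ ⊗ b_π₄)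
  -- with signs (⁻,⁻,⁻), (⁺,⁺,⁻), (⁻,⁺,⁺), (⁺,⁻,⁺) and π = 1234, 2143, 3412, 4321 for k = 1, 2, 3, 4;
  -- the identities for _·_ below are proved coordinatewise in this form.
  infix 8 _◃_
  _◃_ : Sign → Zmod n → Zmod n
  ⁺ ◃ u = u
  ⁻ ◃ u = negZ u

  signedSum : Sign → Sign → Sign → Zmod n → Zmod n → Zmod n → Zmod n → Zmod n
  signedSum s₁ s₂ s₃ u₁ u₂ u₃ u₄ = u₁ ⊕ s₁ ◃ u₂ ⊕ s₂ ◃ u₃ ⊕ s₃ ◃ u₄

  ◃-⊕ : ∀ s u v → s ◃ (u ⊕ v) ≡ s ◃ u ⊕ s ◃ v
  ◃-⊕ ⁺ u v = refl
  ◃-⊕ ⁻ u v = sym (RP.-‿+-comm u v)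

  ◃-zero : ∀ s → s ◃ zeroZ ≡ zeroZ
  ◃-zero ⁺ = refl
  ◃-zero ⁻ = RP.-0#≈0#

  ◃-≡zero : ∀ s {u} → s ◃ u ≡ zeroZ → u ≡ zeroZ
  ◃-≡zero ⁺ e = e
  ◃-≡zero ⁻ e = RP.-‿injective (trans e (sym RP.-0#≈0#))

  signedSum-cong : ∀ s₁ s₂ s₃ {u₁ u₂ u₃ u₄ v₁ v₂ v₃ v₄} → u₁ ≡ v₁ → u₂ ≡ v₂ → u₃ ≡ v₃ → u₄ ≡ v₄ →
    signedSum s₁ s₂ s₃ u₁ u₂ u₃ u₄ ≡ signedSum s₁ s₂ s₃ v₁ v₂ v₃ v₄
  signedSum-cong s₁ s₂ s₃ refl refl refl refl = refl

  signedSum-⊕ : ∀ s₁ s₂ s₃ u₁ u₂ u₃ u₄ v₁ v₂ v₃ v₄ →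
    signedSum s₁ s₂ s₃ (u₁ ⊕ v₁) (u₂ ⊕ v₂) (u₃ ⊕ v₃) (u₄ ⊕ v₄)
      ≡ signedSum s₁ s₂ s₃ u₁ u₂ u₃ u₄ ⊕ signedSum s₁ s₂ s₃ v₁ v₂ v₃ v₄
  signedSum-⊕ s₁ s₂ s₃ u₁ u₂ u₃ u₄ v₁ v₂ v₃ v₄ = begin
    (u₁ ⊕ v₁) ⊕ s₁ ◃ (u₂ ⊕ v₂) ⊕ s₂ ◃ (u₃ ⊕ v₃) ⊕ s₃ ◃ (u₄ ⊕ v₄)
      ≡⟨ cong₂ _⊕_ (cong₂ _⊕_ (cong₂ _⊕_ refl (◃-⊕ s₁ u₂ v₂)) (◃-⊕ s₂ u₃ v₃)) (◃-⊕ s₃ u₄ v₄) ⟩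
    (u₁ ⊕ v₁) ⊕ (s₁ ◃ u₂ ⊕ s₁ ◃ v₂) ⊕ (s₂ ◃ u₃ ⊕ s₂ ◃ v₃) ⊕ (s₃ ◃ u₄ ⊕ s₃ ◃ v₄)
      ≡⟨ cong (λ t → t ⊕ _ ⊕ _) (interchange u₁ v₁ _ _) ⟩
    (u₁ ⊕ s₁ ◃ u₂ ⊕ (v₁ ⊕ s₁ ◃ v₂)) ⊕ (s₂ ◃ u₃ ⊕ s₂ ◃ v₃) ⊕ (s₃ ◃ u₄ ⊕ s₃ ◃ v₄)
      ≡⟨ cong (_⊕ _) (interchange (u₁ ⊕ s₁ ◃ u₂) _ _ _) ⟩
    (u₁ ⊕ s₁ ◃ u₂ ⊕ s₂ ◃ u₃ ⊕ (v₁ ⊕ s₁ ◃ v₂ ⊕ s₂ ◃ v₃)) ⊕ (s₃ ◃ u₄ ⊕ s₃ ◃ v₄)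
      ≡⟨ interchange (u₁ ⊕ s₁ ◃ u₂ ⊕ s₂ ◃ u₃) _ _ _ ⟩
    signedSum s₁ s₂ s₃ u₁ u₂ u₃ u₄ ⊕ signedSum s₁ s₂ s₃ v₁ v₂ v₃ v₄ ∎
    where
    open ≡-Reasoning
    open CommutativeSemigroupProperties R.+-commutativeSemigroup using (interchange)

  private
    ⊕-◃zero : ∀ s u → u ⊕ s ◃ zeroZ ≡ u
    ⊕-◃zero s u = trans (cong (u ⊕_) (◃-zero s)) (R.+-identityʳ u)

    ⊕-◃zero₂ : ∀ s₁ s₂ u → u ⊕ s₁ ◃ zeroZ ⊕ s₂ ◃ zeroZ ≡ u
    ⊕-◃zero₂ s₁ s₂ u = trans (cong (_⊕ s₂ ◃ zeroZ) (⊕-◃zero s₁ u)) (⊕-◃zero s₂ u)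

  signedSum-single₁ : ∀ s₁ s₂ s₃ {u₁ u₂ u₃ u₄ v} → u₁ ≡ v → u₂ ≡ zeroZ → u₃ ≡ zeroZ → u₄ ≡ zeroZ →
    signedSum s₁ s₂ s₃ u₁ u₂ u₃ u₄ ≡ v
  signedSum-single₁ s₁ s₂ s₃ {v = v} refl refl refl refl =
    trans (cong (λ t → t ⊕ s₂ ◃ zeroZ ⊕ s₃ ◃ zeroZ) (⊕-◃zero s₁ v)) (⊕-◃zero₂ s₂ s₃ v)

  signedSum-single₂ : ∀ s₁ s₂ s₃ {u₁ u₂ u₃ u₄ v} → u₁ ≡ zeroZ → u₂ ≡ v → u₃ ≡ zeroZ → u₄ ≡ zeroZ →
    signedSum s₁ s₂ s₃ u₁ u₂ u₃ u₄ ≡ s₁ ◃ v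
  signedSum-single₂ s₁ s₂ s₃ {v = v} refl refl refl refl =
    trans (cong (λ t → t ⊕ s₂ ◃ zeroZ ⊕ s₃ ◃ zeroZ) (R.+-identityˡ (s₁ ◃ v))) (⊕-◃zero₂ s₂ s₃ (s₁ ◃ v))

  signedSum-single₃ : ∀ s₁ s₂ s₃ {u₁ u₂ u₃ u₄ v} → u₁ ≡ zeroZ → u₂ ≡ zeroZ → u₃ ≡ v → u₄ ≡ zeroZ →
    signedSum s₁ s₂ s₃ u₁ u₂ u₃ u₄ ≡ s₂ ◃ v
  signedSum-single₃ s₁ s₂ s₃ {v = v} refl refl refl refl =
    trans (cong (λ t → t ⊕ s₂ ◃ v ⊕ s₃ ◃ zeroZ) (⊕-◃zero s₁ zeroZ))
      (trans (cong (_⊕ s₃ ◃ zeroZ) (R.+-identityˡ (s₂ ◃ v))) (⊕-◃zero s₃ (s₂ ◃ v)))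

  signedSum-single₄ : ∀ s₁ s₂ s₃ {u₁ u₂ u₃ u₄ v} → u₁ ≡ zeroZ → u₂ ≡ zeroZ → u₃ ≡ zeroZ → u₄ ≡ v →
    signedSum s₁ s₂ s₃ u₁ u₂ u₃ u₄ ≡ s₃ ◃ v
  signedSum-single₄ s₁ s₂ s₃ {v = v} refl refl refl refl =
    trans (cong (_⊕ s₃ ◃ v) (⊕-◃zero₂ s₁ s₂ zeroZ)) (R.+-identityˡ (s₃ ◃ v))

  signedSum-≡zero : ∀ s₁ s₂ s₃ {u₁ u₂ u₃ u₄} → u₁ ≡ zeroZ → u₂ ≡ zeroZ → u₃ ≡ zeroZ → u₄ ≡ zeroZ →
    signedSum s₁ s₂ s₃ u₁ u₂ u₃ u₄ ≡ zeroZ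
  signedSum-≡zero s₁ s₂ s₃ = signedSum-single₁ s₁ s₂ s₃

  ·-zeroʳ : ∀ x → x · 0H ≡ 0H
  ·-zeroʳ (quat a1 a2 a3 a4) = quat-cong (zeros ⁻ ⁻ ⁻) (zeros ⁺ ⁺ ⁻) (zeros ⁻ ⁺ ⁺) (zeros ⁺ ⁻ ⁺)
    where
    zeros : ∀ s₁ s₂ s₃ → signedSum s₁ s₂ s₃ (a1 ⊗ zeroZ) (a2 ⊗ zeroZ) (a3 ⊗ zeroZ) (a4 ⊗ zeroZ) ≡ zeroZ
    zeros s₁ s₂ s₃ = signedSum-≡zero s₁ s₂ s₃ (R.zeroʳ a1) (R.zeroʳ a2) (R.zeroʳ a3) (R.zeroʳ a4)

  ·-zeroˡ : ∀ x → 0H · x ≡ 0H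
  ·-zeroˡ (quat b1 b2 b3 b4) = quat-cong
    (signedSum-≡zero ⁻ ⁻ ⁻ (R.zeroˡ b1) (R.zeroˡ b2) (R.zeroˡ b3) (R.zeroˡ b4))
    (signedSum-≡zero ⁺ ⁺ ⁻ (R.zeroˡ b2) (R.zeroˡ b1) (R.zeroˡ b4) (R.zeroˡ b3))
    (signedSum-≡zero ⁻ ⁺ ⁺ (R.zeroˡ b3) (R.zeroˡ b4) (R.zeroˡ b1) (R.zeroˡ b2))
    (signedSum-≡zero ⁺ ⁻ ⁺ (R.zeroˡ b4) (R.zeroˡ b3) (R.zeroˡ b2) (R.zeroˡ b1))

  ·-identityʳ : ∀ x → x · 1H ≡ x
  ·-identityʳ (quat a1 a2 a3 a4) = quat-cong
    (signedSum-single₁ ⁻ ⁻ ⁻ (R.*-identityʳ a1) (R.zeroʳ a2) (R.zeroʳ a3) (R.zeroʳ a4))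
    (signedSum-single₂ ⁺ ⁺ ⁻ (R.zeroʳ a1) (R.*-identityʳ a2) (R.zeroʳ a3) (R.zeroʳ a4))
    (signedSum-single₃ ⁻ ⁺ ⁺ (R.zeroʳ a1) (R.zeroʳ a2) (R.*-identityʳ a3) (R.zeroʳ a4))
    (signedSum-single₄ ⁺ ⁻ ⁺ (R.zeroʳ a1) (R.zeroʳ a2) (R.zeroʳ a3) (R.*-identityʳ a4))

  ·-distribˡ-⊞ : ∀ x y z → x · (y ⊞ z) ≡ x · y ⊞ x · z
  ·-distribˡ-⊞ (quat a1 a2 a3 a4) (quat b1 b2 b3 b4) (quat c1 c2 c3 c4) = quat-cong
    (distrib ⁻ ⁻ ⁻ b1 b2 b3 b4 c1 c2 c3 c4)
    (distrib ⁺ ⁺ ⁻ b2 b1 b4 b3 c2 c1 c4 c3)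
    (distrib ⁻ ⁺ ⁺ b3 b4 b1 b2 c3 c4 c1 c2)
    (distrib ⁺ ⁻ ⁺ b4 b3 b2 b1 c4 c3 c2 c1)
    where
    distrib : ∀ s₁ s₂ s₃ b₁ b₂ b₃ b₄ c₁ c₂ c₃ c₄ →
      signedSum s₁ s₂ s₃ (a1 ⊗ (b₁ ⊕ c₁)) (a2 ⊗ (b₂ ⊕ c₂)) (a3 ⊗ (b₃ ⊕ c₃)) (a4 ⊗ (b₄ ⊕ c₄))
        ≡ signedSum s₁ s₂ s₃ (a1 ⊗ b₁) (a2 ⊗ b₂) (a3 ⊗ b₃) (a4 ⊗ b₄)
          ⊕ signedSum s₁ s₂ s₃ (a1 ⊗ c₁) (a2 ⊗ c₂) (a3 ⊗ c₃) (a4 ⊗ c₄)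
    distrib s₁ s₂ s₃ b₁ b₂ b₃ b₄ c₁ c₂ c₃ c₄ = trans
      (signedSum-cong s₁ s₂ s₃ (R.distribˡ a1 b₁ c₁) (R.distribˡ a2 b₂ c₂) (R.distribˡ a3 b₃ c₃) (R.distribˡ a4 b₄ c₄))
      (signedSum-⊕ s₁ s₂ s₃ _ _ _ _ _ _ _ _)

  ⊞-identityˡ : ∀ x → 0H ⊞ x ≡ x
  ⊞-identityˡ (quat a1 a2 a3 a4) = quat-cong (R.+-identityˡ a1) (R.+-identityˡ a2) (R.+-identityˡ a3) (R.+-identityˡ a4)

  ·-⊞1H : ∀ x y → x · (y ⊞ 1H) ≡ x · y ⊞ x
  ·-⊞1H x y = trans (·-distribˡ-⊞ x y 1H) (cong (x · y ⊞_) (·-identityʳ x))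

  ·-minusOne≡0H⇒≡0H : ∀ {x} → x · -1H ≡ 0H → x ≡ 0H
  ·-minusOne≡0H⇒≡0H {x} x·-1≡0 = begin
    x                   ≡⟨ ⊞-identityˡ x ⟨
    0H ⊞ x              ≡⟨ cong (_⊞ x) x·-1≡0 ⟨
    x · -1H ⊞ x         ≡⟨ ·-⊞1H x -1H ⟨
    x · (-1H ⊞ 1H)      ≡⟨ cong (x ·_) -1H⊞1H≡0H ⟩
    x · 0H              ≡⟨ ·-zeroʳ x ⟩
    0H                  ∎
    where
    open ≡-Reasoning
    -1H⊞1H≡0H : -1H ⊞ 1H ≡ 0H
    -1H⊞1H≡0H = quat-cong (R.-‿inverseˡ oneZ) (R.+-identityˡ zeroZ) (R.+-identityˡ zeroZ) (R.+-identityˡ zeroZ)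

  iH jH kH : H n
  iH = quat zeroZ oneZ zeroZ zeroZ
  jH = quat zeroZ zeroZ oneZ zeroZ
  kH = quat zeroZ zeroZ zeroZ oneZ

  iH·quat : ∀ b1 b2 b3 b4 → iH · quat b1 b2 b3 b4 ≡ quat (negZ b2) b1 (negZ b4) b3
  iH·quat b1 b2 b3 b4 = quat-cong
    (signedSum-single₂ ⁻ ⁻ ⁻ (R.zeroˡ b1) (R.*-identityˡ b2) (R.zeroˡ b3) (R.zeroˡ b4))
    (signedSum-single₂ ⁺ ⁺ ⁻ (R.zeroˡ b2) (R.*-identityˡ b1) (R.zeroˡ b4) (R.zeroˡ b3))
    (signedSum-single₂ ⁻ ⁺ ⁺ (R.zeroˡ b3) (R.*-identityˡ b4) (R.zeroˡ b1) (R.zeroˡ b2))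
    (signedSum-single₂ ⁺ ⁻ ⁺ (R.zeroˡ b4) (R.*-identityˡ b3) (R.zeroˡ b2) (R.zeroˡ b1))

  jH·quat : ∀ b1 b2 b3 b4 → jH · quat b1 b2 b3 b4 ≡ quat (negZ b3) b4 b1 (negZ b2)
  jH·quat b1 b2 b3 b4 = quat-cong
    (signedSum-single₃ ⁻ ⁻ ⁻ (R.zeroˡ b1) (R.zeroˡ b2) (R.*-identityˡ b3) (R.zeroˡ b4))
    (signedSum-single₃ ⁺ ⁺ ⁻ (R.zeroˡ b2) (R.zeroˡ b1) (R.*-identityˡ b4) (R.zeroˡ b3))
    (signedSum-single₃ ⁻ ⁺ ⁺ (R.zeroˡ b3) (R.zeroˡ b4) (R.*-identityˡ b1) (R.zeroˡ b2))
    (signedSum-single₃ ⁺ ⁻ ⁺ (R.zeroˡ b4) (R.zeroˡ b3) (R.*-identityˡ b2) (R.zeroˡ b1))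

  iH-leftRegular : ∀ y → iH · y ≡ 0H → y ≡ 0H
  iH-leftRegular (quat b1 b2 b3 b4) iy≡0 =
    let -b2≡0 , b1≡0 , -b4≡0 , b3≡0 = quat≡0H (trans (sym (iH·quat b1 b2 b3 b4)) iy≡0)
    in quat-cong b1≡0 (◃-≡zero ⁻ -b2≡0) b3≡0 (◃-≡zero ⁻ -b4≡0)

  jH-leftRegular : ∀ y → jH · y ≡ 0H → y ≡ 0H
  jH-leftRegular (quat b1 b2 b3 b4) jy≡0 =
    let -b3≡0 , b4≡0 , b1≡0 , -b2≡0 = quat≡0H (trans (sym (jH·quat b1 b2 b3 b4)) jy≡0)
    in quat-cong b1≡0 (◃-≡zero ⁻ -b2≡0) (◃-≡zero ⁻ -b3≡0) b4≡0

  ·-self≡0H : (∀ a b → a ⊕ a ≡ zeroZ → b ⊕ b ≡ zeroZ → a ⊗ b ≡ zeroZ) →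
    ∀ x → x ⊞ x ≡ 0H → x · x ≡ 0H
  ·-self≡0H t (quat a1 a2 a3 a4) x+x≡0 =
    let e1 , e2 , e3 , e4 = quat≡0H x+x≡0 in quat-cong
    (signedSum-≡zero ⁻ ⁻ ⁻ (t a1 a1 e1 e1) (t a2 a2 e2 e2) (t a3 a3 e3 e3) (t a4 a4 e4 e4))
    (signedSum-≡zero ⁺ ⁺ ⁻ (t a1 a2 e1 e2) (t a2 a1 e2 e1) (t a3 a4 e3 e4) (t a4 a3 e4 e3))
    (signedSum-≡zero ⁻ ⁺ ⁺ (t a1 a3 e1 e3) (t a2 a4 e2 e4) (t a3 a1 e3 e1) (t a4 a2 e4 e2))
    (signedSum-≡zero ⁺ ⁻ ⁺ (t a1 a4 e1 e4) (t a2 a3 e2 e3) (t a3 a2 e3 e2) (t a4 a1 e4 e1))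

  coordSum : H n → Zmod n
  coordSum (quat b1 b2 b3 b4) = b1 ⊕ b2 ⊕ b3 ⊕ b4

  coordSum-⊞1H : ∀ y → coordSum (y ⊞ 1H) ≡ coordSum y ⊕ oneZ
  coordSum-⊞1H (quat b1 b2 b3 b4) = begin
    b1 ⊕ oneZ ⊕ (b2 ⊕ zeroZ) ⊕ (b3 ⊕ zeroZ) ⊕ (b4 ⊕ zeroZ)
      ≡⟨ cong₂ _⊕_ (cong₂ _⊕_ (cong₂ _⊕_ refl (R.+-identityʳ b2)) (R.+-identityʳ b3)) (R.+-identityʳ b4) ⟩
    b1 ⊕ oneZ ⊕ b2 ⊕ b3 ⊕ b4
      ≡⟨ +-Solver.solve 5 (λ b1 b2 b3 b4 o → b1 ⊕′ o ⊕′ b2 ⊕′ b3 ⊕′ b4 ⊜ b1 ⊕′ b2 ⊕′ b3 ⊕′ b4 ⊕′ o) refl b1 b2 b3 b4 oneZ ⟩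
    b1 ⊕ b2 ⊕ b3 ⊕ b4 ⊕ oneZ ∎
    where
    open ≡-Reasoning

  coordSum-⊞1H-odd : ∀ y {t} → coordSum y ≡ t ⊕ t ⊕ oneZ → coordSum (y ⊞ 1H) ≡ (t ⊕ oneZ) ⊕ (t ⊕ oneZ)
  coordSum-⊞1H-odd y {t} Σy≡2t+1 = begin
    coordSum (y ⊞ 1H)            ≡⟨ coordSum-⊞1H y ⟩
    coordSum y ⊕ oneZ            ≡⟨ cong (_⊕ oneZ) Σy≡2t+1 ⟩
    t ⊕ t ⊕ oneZ ⊕ oneZ          ≡⟨ +-Solver.solve 2 (λ t o → t ⊕′ t ⊕′ o ⊕′ o ⊜ (t ⊕′ o) ⊕′ (t ⊕′ o)) refl t oneZ ⟩
    (t ⊕ oneZ) ⊕ (t ⊕ oneZ)      ∎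
    where open ≡-Reasoning

  diagonal : Zmod n → H n
  diagonal h = quat h h h h

  diagonal-annihilates-even : ∀ {h} → h ⊕ h ≡ zeroZ → ∀ y {t} → coordSum y ≡ t ⊕ t →
    diagonal h · y ≡ 0H × y · diagonal h ≡ 0H
  diagonal-annihilates-even {h} h⊕h≡0 (quat b1 b2 b3 b4) {t} Σb≡t+t =
    quat-cong (vanish ⁻ ⁻ ⁻ refl)
      (vanish ⁺ ⁺ ⁻ (+-Solver.solve 4 (λ b1 b2 b3 b4 → b2 ⊕′ b1 ⊕′ b4 ⊕′ b3 ⊜ b1 ⊕′ b2 ⊕′ b3 ⊕′ b4) refl b1 b2 b3 b4))
      (vanish ⁻ ⁺ ⁺ (+-Solver.solve 4 (λ b1 b2 b3 b4 → b3 ⊕′ b4 ⊕′ b1 ⊕′ b2 ⊜ b1 ⊕′ b2 ⊕′ b3 ⊕′ b4) refl b1 b2 b3 b4))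
      (vanish ⁺ ⁻ ⁺ (+-Solver.solve 4 (λ b1 b2 b3 b4 → b4 ⊕′ b3 ⊕′ b2 ⊕′ b1 ⊜ b1 ⊕′ b2 ⊕′ b3 ⊕′ b4) refl b1 b2 b3 b4))
    , quat-cong (vanishʳ ⁻ ⁻ ⁻) (vanishʳ ⁺ ⁺ ⁻) (vanishʳ ⁻ ⁺ ⁺) (vanishʳ ⁺ ⁻ ⁺)
    where
    open ≡-Reasoning
    -h≡h : negZ h ≡ h
    -h≡h = sym (RP.+-inverseʳ-unique h h h⊕h≡0)
    ◃-h⊗ : ∀ s c → s ◃ (h ⊗ c) ≡ h ⊗ c
    ◃-h⊗ ⁺ c = refl
    ◃-h⊗ ⁻ c = trans (RP.-‿distribˡ-* h c) (cong (_⊗ c) -h≡h)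
    vanish : ∀ s₁ s₂ s₃ {c₁ c₂ c₃ c₄} → c₁ ⊕ c₂ ⊕ c₃ ⊕ c₄ ≡ b1 ⊕ b2 ⊕ b3 ⊕ b4 →
      signedSum s₁ s₂ s₃ (h ⊗ c₁) (h ⊗ c₂) (h ⊗ c₃) (h ⊗ c₄) ≡ zeroZ
    vanish s₁ s₂ s₃ {c₁} {c₂} {c₃} {c₄} Σc≡Σb = begin
      h ⊗ c₁ ⊕ s₁ ◃ (h ⊗ c₂) ⊕ s₂ ◃ (h ⊗ c₃) ⊕ s₃ ◃ (h ⊗ c₄)
        ≡⟨ cong₂ _⊕_ (cong₂ _⊕_ (cong₂ _⊕_ refl (◃-h⊗ s₁ c₂)) (◃-h⊗ s₂ c₃)) (◃-h⊗ s₃ c₄) ⟩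
      h ⊗ c₁ ⊕ h ⊗ c₂ ⊕ h ⊗ c₃ ⊕ h ⊗ c₄
        ≡⟨ cong₂ _⊕_ (cong₂ _⊕_ (R.distribˡ h c₁ c₂) refl) refl ⟨
      h ⊗ (c₁ ⊕ c₂) ⊕ h ⊗ c₃ ⊕ h ⊗ c₄
        ≡⟨ cong₂ _⊕_ (R.distribˡ h (c₁ ⊕ c₂) c₃) refl ⟨
      h ⊗ (c₁ ⊕ c₂ ⊕ c₃) ⊕ h ⊗ c₄
        ≡⟨ R.distribˡ h (c₁ ⊕ c₂ ⊕ c₃) c₄ ⟨
      h ⊗ (c₁ ⊕ c₂ ⊕ c₃ ⊕ c₄)
        ≡⟨ cong (h ⊗_) (trans Σc≡Σb Σb≡t+t) ⟩
      h ⊗ (t ⊕ t)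
        ≡⟨ R.distribˡ h t t ⟩
      h ⊗ t ⊕ h ⊗ t
        ≡⟨ R.distribʳ t h h ⟨
      (h ⊕ h) ⊗ t
        ≡⟨ cong (_⊗ t) h⊕h≡0 ⟩
      zeroZ ⊗ t
        ≡⟨ R.zeroˡ t ⟩
      zeroZ ∎
    vanishʳ : ∀ s₁ s₂ s₃ → signedSum s₁ s₂ s₃ (b1 ⊗ h) (b2 ⊗ h) (b3 ⊗ h) (b4 ⊗ h) ≡ zeroZ
    vanishʳ s₁ s₂ s₃ = trans (signedSum-cong s₁ s₂ s₃ (R.*-comm b1 h) (R.*-comm b2 h) (R.*-comm b3 h) (R.*-comm b4 h))
                             (vanish s₁ s₂ s₃ refl)

-- Degrees in Φ(H(ℤ/2ⁿ)) via two-sided annihilators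

module Degree (n : ℕ) where

  open QuaternionArithmetic n
  open Enumeration n
  open Counting _≟H_ (allH n) allH! ∈allH public

  Ann : H n → H n → Set
  Ann x y = x · y ≡ 0H × y · x ≡ 0H

  ann? : ∀ x → Decidable (Ann x)
  ann? x y = ((x · y) ≟H 0H) ×-dec ((y · x) ≟H 0H)

  nonAnn? : ∀ x → Decidable (λ y → ¬ Ann x y)
  nonAnn? x = ¬? ∘ ann? x

  Ann-0H : ∀ x → Ann x 0H
  Ann-0H x = ·-zeroʳ x , ·-zeroˡ x

  ¬Ann-1H : ∀ {x} → x ≢ 0H → ¬ Ann x 1H
  ¬Ann-1H x≢0 (x1≡0 , _) = x≢0 (trans (sym (·-identityʳ _)) x1≡0)

  ¬Ann-minusOne : ∀ {x} → x ≢ 0H → ¬ Ann x -1H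
  ¬Ann-minusOne x≢0 (x-1≡0 , _) = x≢0 (·-minusOne≡0H⇒≡0H x-1≡0)

  ¬Ann-⊞1H : ∀ {x y} → x ≢ 0H → Ann x y → ¬ Ann x (y ⊞ 1H)
  ¬Ann-⊞1H {x} {y} x≢0 (xy≡0 , _) (xy1≡0 , _) = x≢0 (begin
    x               ≡⟨ ⊞-identityˡ x ⟨
    0H ⊞ x          ≡⟨ cong (_⊞ x) xy≡0 ⟨
    x · y ⊞ x       ≡⟨ ·-⊞1H x y ⟨
    x · (y ⊞ 1H)    ≡⟨ xy1≡0 ⟩
    0H              ∎)
    where open ≡-Reasoning

  Adj⇒¬Ann : ∀ {x y} → Adj x y → ¬ Ann x y
  Adj⇒¬Ann (_ , _ , _ , inj₁ xy≢0) (xy≡0 , _) = xy≢0 xy≡0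
  Adj⇒¬Ann (_ , _ , _ , inj₂ yx≢0) (_ , yx≡0) = yx≢0 yx≡0

  ¬Ann⇒Adj : ∀ {x y} → IsVertex x → ¬ Ann x y → y ≢ 1H → y ≢ -1H → y ≢ x → Adj x y
  ¬Ann⇒Adj {x} {y} vx ¬xy y≢1 y≢-1 y≢x = vx , (y≢0 , y≢1 , y≢-1) , (λ x≡y → y≢x (sym x≡y)) , nonzero-product
    where
    y≢0 : y ≢ 0H
    y≢0 y≡0 = ¬xy (subst (Ann x) (sym y≡0) (Ann-0H x))
    nonzero-product : x · y ≢ 0H ⊎ y · x ≢ 0H
    nonzero-product = [ (λ xy≡0 → inj₂ (λ yx≡0 → ¬xy (xy≡0 , yx≡0))) , inj₁ ]′ (toSum ((x · y) ≟H 0H))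

  ¬Ann∧¬Adj⇒∈ : ∀ {x y} → IsVertex x → ¬ Ann x y → ¬ Adj x y → y ∈ 1H ∷ -1H ∷ x ∷ []
  ¬Ann∧¬Adj⇒∈ {x} {y} vx ¬xy ¬adj = classify (y ≟H 1H) (y ≟H -1H)
    where
    classify : Dec (y ≡ 1H) → Dec (y ≡ -1H) → y ∈ 1H ∷ -1H ∷ x ∷ []
    classify (yes y≡1) _ = here y≡1
    classify (no _) (yes y≡-1) = there (here y≡-1)
    classify (no y≢1) (no y≢-1) =
      there (there (here (decidable-stable (y ≟H x) λ y≢x → ¬adj (¬Ann⇒Adj vx ¬xy y≢1 y≢-1 y≢x))))

  ¬Adj-0H : ∀ {x : H n} → ¬ Adj x 0H
  ¬Adj-0H (_ , (y≢0 , _) , _) = y≢0 refl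

  ¬Adj-1H : ∀ {x : H n} → ¬ Adj x 1H
  ¬Adj-1H (_ , (_ , y≢1 , _) , _) = y≢1 refl

  ¬Adj-minusOne : ∀ {x : H n} → ¬ Adj x -1H
  ¬Adj-minusOne (_ , (_ , _ , y≢-1) , _) = y≢-1 refl

  ¬Adj-self : ∀ {x : H n} → ¬ Adj x x
  ¬Adj-self (_ , _ , x≢x , _) = x≢x refl

  count-ann+count-nonAnn : ∀ x → count (ann? x) + count (nonAnn? x) ≡ length (allH n)
  count-ann+count-nonAnn x = count-complement (ann? x)

  count-ann≤count-nonAnn : ∀ {x} → x ≢ 0H → count (ann? x) ≤ count (nonAnn? x)
  count-ann≤count-nonAnn x≢0 =
    count-≤-injection (ann? _) (nonAnn? _) (_⊞ 1H) (⊞-cancelʳ 1H) (λ _ → ¬Ann-⊞1H x≢0)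

  count-nonAnn≤3+deg : ∀ {x} → IsVertex x → count (nonAnn? x) ≤ 3 + deg x
  count-nonAnn≤3+deg {x} vx = count-≤-length+count (nonAnn? x) (adj? x) λ y ¬xy →
    [ inj₂ , (λ ¬adj → inj₁ (¬Ann∧¬Adj⇒∈ vx ¬xy ¬adj)) ]′ (toSum (adj? x y))

  count-nonAnn≤2+deg : ∀ {x} → IsVertex x → Ann x x → count (nonAnn? x) ≤ 2 + deg x
  count-nonAnn≤2+deg {x} vx xx = count-≤-length+count (nonAnn? x) (adj? x) λ y ¬xy →
    [ inj₂ , (λ ¬adj → inj₁ (drop-self ¬xy (¬Ann∧¬Adj⇒∈ vx ¬xy ¬adj))) ]′ (toSum (adj? x y))
    where
    drop-self : ∀ {y} → ¬ Ann x y → y ∈ 1H ∷ -1H ∷ x ∷ [] → y ∈ 1H ∷ -1H ∷ []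
    drop-self _ (here y≡1) = here y≡1
    drop-self _ (there (here y≡-1)) = there (here y≡-1)
    drop-self ¬xy (there (there (here y≡x))) = contradiction (subst (Ann x) (sym y≡x) xx) ¬xy

  deg+2≤count-nonAnn : ∀ {x} → IsVertex x → 1H {n} ≢ -1H → deg x + 2 ≤ count (nonAnn? x)
  deg+2≤count-nonAnn {x} (x≢0 , _) 1≢-1 =
    count+length-≤-count (nonAnn? x) (adj? x) ((1≢-1 ∷ []) ∷ [] ∷ []) (λ _ → Adj⇒¬Ann) ±1-nonAdjacent
    where
    ±1-nonAdjacent : ∀ {y} → y ∈ 1H ∷ -1H ∷ [] → ¬ Ann x y × ¬ Adj x y
    ±1-nonAdjacent (here refl) = ¬Ann-1H x≢0 , ¬Adj-1H
    ±1-nonAdjacent (there (here refl)) = ¬Ann-minusOne x≢0 , ¬Adj-minusOne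

  deg+4≤|H| : ∀ {x} → IsVertex x → Unique (0H {n} ∷ 1H ∷ -1H ∷ []) → deg x + 4 ≤ length (allH n)
  deg+4≤|H| {x} (x≢0 , x≢1 , x≢-1) ((0≢1 ∷ 0≢-1 ∷ []) ∷ (1≢-1 ∷ []) ∷ [] ∷ []) = begin
    deg x + 4                     ≤⟨ +-monoʳ-≤ (deg x) (length-≤-count (¬? ∘ adj? x) four! nonAdjacent) ⟩
    deg x + count (¬? ∘ adj? x)   ≡⟨ count-complement (adj? x) ⟩
    length (allH n)               ∎
    where
    open ≤-Reasoning
    four! : Unique (0H ∷ 1H ∷ -1H ∷ x ∷ [])
    four! = (0≢1 ∷ 0≢-1 ∷ (x≢0 ∘ sym) ∷ []) ∷ (1≢-1 ∷ (x≢1 ∘ sym) ∷ []) ∷ ((x≢-1 ∘ sym) ∷ []) ∷ [] ∷ []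
    nonAdjacent : ∀ {y} → y ∈ 0H ∷ 1H ∷ -1H ∷ x ∷ [] → ¬ Adj x y
    nonAdjacent (here refl) = ¬Adj-0H
    nonAdjacent (there (here refl)) = ¬Adj-1H
    nonAdjacent (there (there (here refl))) = ¬Adj-minusOne
    nonAdjacent (there (there (there (here refl)))) = ¬Adj-self

  |H|≤4+deg : ∀ {x} → IsVertex x → (∀ y → x · y ≡ 0H → y ≡ 0H) → length (allH n) ≤ 4 + deg x
  |H|≤4+deg {x} vx x-leftRegular = begin
    length (allH n)                 ≡⟨ count-complement (adj? x) ⟨
    deg x + count (¬? ∘ adj? x)     ≤⟨ +-monoʳ-≤ (deg x) (count-≤-length (¬? ∘ adj? x) classify) ⟩
    deg x + 4                       ≡⟨ +-comm (deg x) 4 ⟩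
    4 + deg x                       ∎
    where
    open ≤-Reasoning
    classify : ∀ y → ¬ Adj x y → y ∈ 0H ∷ 1H ∷ -1H ∷ x ∷ []
    classify y ¬adj = [ here , (λ y≢0 → there (¬Ann∧¬Adj⇒∈ vx (¬xy y≢0) ¬adj)) ]′ (toSum (y ≟H 0H))
      where
      ¬xy : y ≢ 0H → ¬ Ann x y
      ¬xy y≢0 (xy≡0 , _) = y≢0 (x-leftRegular y xy≡0)

module Units (m : ℕ) where

  open QuaternionArithmetic (suc m)

  private
    1≢0 : ¬ oneZ {suc m} ≡ zeroZ
    1≢0 = oneZ≢zeroZ m

  iH-vertex : IsVertex iH
  iH-vertex = nonreal⇒vertex (inj₁ 1≢0)

  jH-vertex : IsVertex jH
  jH-vertex = nonreal⇒vertex (inj₂ (inj₁ 1≢0))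

  kH-vertex : IsVertex kH
  kH-vertex = nonreal⇒vertex (inj₂ (inj₂ 1≢0))

  triangle : Girth3 (suc m)
  triangle = iH , jH , kH
    , (iH-vertex , jH-vertex , (λ i≡j → 1≢0 (cong a₂ i≡j)) , inj₁ (λ ij≡0 → 1≢0 (cong a₃ (iH-leftRegular jH ij≡0))))
    , (jH-vertex , kH-vertex , (λ j≡k → 1≢0 (cong a₃ j≡k)) , inj₁ (λ jk≡0 → 1≢0 (cong a₄ (jH-leftRegular kH jk≡0))))
    , (kH-vertex , iH-vertex , (λ k≡i → 1≢0 (cong a₄ k≡i)) , inj₂ (λ ik≡0 → 1≢0 (cong a₄ (iH-leftRegular kH ik≡0))))

-- n ≥ 2: minimum and maximum degree

module LargeDegrees (k : ℕ) where

  private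
    n : ℕ
    n = 2 + k

  open ZmodRing n using (⊕-inverseʳ; even⊎odd)
  open QuaternionArithmetic n
  open Enumeration n
  open Degree n
  open Units (suc k) using (iH-vertex)

  N K : ℕ
  N = 2 ^ (4 * n)
  K = 2 ^ (4 * n ∸ 1)

  |H|≡K+K : length (allH n) ≡ K + K
  |H|≡K+K = trans length-allH (cong (K +_) (+-identityʳ K))

  1H≢-1H : 1H {n} ≢ -1H
  1H≢-1H 1≡-1 = two≢zeroZ k (trans (cong (oneZ ⊕_) (cong a₁ 1≡-1)) (⊕-inverseʳ oneZ))

  units! : Unique (0H {n} ∷ 1H ∷ -1H ∷ [])
  units! = ((λ 0≡1 → 1≢0 (sym (cong a₁ 0≡1))) ∷ (λ 0≡-1 → 1≢0 (◃-≡zero ⁻ (sym (cong a₁ 0≡-1)))) ∷ [])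
         ∷ (1H≢-1H ∷ []) ∷ [] ∷ []
    where
    1≢0 : ¬ oneZ {n} ≡ zeroZ
    1≢0 = oneZ≢zeroZ (suc k)

  count-ann<count-nonAnn : ∀ {x} → IsVertex x → ¬ Ann x x → count (ann? x) < count (nonAnn? x)
  count-ann<count-nonAnn {x} (x≢0 , _) ¬xx = begin-strict
    count (ann? x)               ≤⟨ count-≤-injection (ann? x) nonAnn∖two? (_⊞ 1H) (⊞-cancelʳ 1H) shift ⟩
    count nonAnn∖two?            <⟨ m<m+n (count nonAnn∖two?) z<s ⟩
    count nonAnn∖two? + 1        ≤⟨ count+length-≤-count (nonAnn? x) nonAnn∖two? ([] ∷ []) (λ _ → proj₁) two-only ⟩
    count (nonAnn? x)            ∎
    where
    open ≤-Reasoning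
    two : H n
    two = 1H ⊞ 1H
    nonAnn∖two? : Decidable (λ y → ¬ Ann x y × y ≢ two)
    nonAnn∖two? y = nonAnn? x y ×-dec ¬? (y ≟H two)
    shift : ∀ y → Ann x y → ¬ Ann x (y ⊞ 1H) × y ⊞ 1H ≢ two
    shift y xy = ¬Ann-⊞1H x≢0 xy , λ y+1≡1+1 → ¬Ann-1H x≢0 (subst (Ann x) (⊞-cancelʳ 1H y+1≡1+1) xy)
    ¬Ann-two : ¬ Ann x two
    ¬Ann-two (x2≡0 , _) = ¬xx (xx≡0 , xx≡0)
      where
      xx≡0 : x · x ≡ 0H
      xx≡0 = ·-self≡0H (⊕-self≡zeroZ⇒⊗≡zeroZ k) x
               (trans (sym (trans (·-⊞1H x 1H) (cong (_⊞ x) (·-identityʳ x)))) x2≡0)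
    two-only : ∀ {y} → y ∈ two ∷ [] → ¬ Ann x y × ¬ (¬ Ann x y × y ≢ two)
    two-only (here refl) = ¬Ann-two , λ (_ , two≢two) → two≢two refl

  K∸2≤deg : ∀ {x} → IsVertex x → K ∸ 2 ≤ deg x
  K∸2≤deg {x} vx@(x≢0 , _) = m≤n+o⇒m∸n≤o K 2 ([ self-annihilating , not-self-annihilating ]′ (toSum (ann? x x)))
    where
    count-sum : count (ann? x) + count (nonAnn? x) ≡ K + K
    count-sum = trans (count-ann+count-nonAnn x) |H|≡K+K
    self-annihilating : Ann x x → K ≤ 2 + deg x
    self-annihilating xx =
      ≤-trans (m+n≡o+o∧m≤n⇒o≤n count-sum (count-ann≤count-nonAnn x≢0)) (count-nonAnn≤2+deg vx xx)
    not-self-annihilating : ¬ Ann x x → K ≤ 2 + deg x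
    not-self-annihilating ¬xx =
      s≤s⁻¹ (≤-trans (m+n≡o+o∧m<n⇒o<n count-sum (count-ann<count-nonAnn vx ¬xx)) (count-nonAnn≤3+deg vx))

  x₀ : H n
  x₀ = diagonal (half (suc k))

  x₀-vertex : IsVertex x₀
  x₀-vertex = nonreal⇒vertex (inj₁ (half≢zeroZ (suc k)))

  count-nonAnn-x₀≤count-ann-x₀ : count (nonAnn? x₀) ≤ count (ann? x₀)
  count-nonAnn-x₀≤count-ann-x₀ = count-≤-injection (nonAnn? x₀) (ann? x₀) (_⊞ 1H) (⊞-cancelʳ 1H) shift
    where
    annihilates-even : ∀ y {t} → coordSum y ≡ t ⊕ t → Ann x₀ y
    annihilates-even = diagonal-annihilates-even (half⊕half≡zeroZ (suc k))
    shift : ∀ y → ¬ Ann x₀ y → Ann x₀ (y ⊞ 1H)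
    shift y ¬x₀y = [ (λ (t , Σy-even) → contradiction (annihilates-even y {t} Σy-even) ¬x₀y)
                   , (λ (t , Σy-odd) → annihilates-even (y ⊞ 1H) {t ⊕ oneZ} (coordSum-⊞1H-odd y Σy-odd)) ]′
                   (even⊎odd (coordSum y))

  deg-x₀ : deg x₀ ≡ K ∸ 2
  deg-x₀ = ≤-antisym (m+n≤o⇒m≤o∸n (deg x₀) (≤-trans (deg+2≤count-nonAnn x₀-vertex 1H≢-1H) nonAnn≤K))
                     (K∸2≤deg x₀-vertex)
    where
    nonAnn≤K : count (nonAnn? x₀) ≤ K
    nonAnn≤K = m+n≡o+o∧n≤m⇒n≤o (trans (count-ann+count-nonAnn x₀) |H|≡K+K) count-nonAnn-x₀≤count-ann-x₀

  deg≤N∸4 : ∀ {x} → IsVertex x → deg x ≤ N ∸ 4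
  deg≤N∸4 {x} vx = m+n≤o⇒m≤o∸n (deg x) (subst (deg x + 4 ≤_) length-allH (deg+4≤|H| vx units!))

  deg-iH : deg iH ≡ N ∸ 4
  deg-iH = ≤-antisym (deg≤N∸4 iH-vertex)
    (m≤n+o⇒m∸n≤o N 4 (subst (_≤ 4 + deg iH) length-allH (|H|≤4+deg iH-vertex iH-leftRegular)))

  min-degree : IsMinDegree n (K ∸ 2)
  min-degree = (x₀ , x₀-vertex , deg-x₀) , λ _ → K∸2≤deg

  max-degree : IsMaxDegree n (N ∸ 4)
  max-degree = (iH , iH-vertex , deg-iH) , λ _ → deg≤N∸4

-- n = 1: direct computation

module SmallDegrees where

  open Enumeration 1
  open QuaternionArithmetic 1 using (iH; diagonal; nonreal⇒vertex)

  7≤deg : ∀ x → IsVertex x → 7 ≤ deg x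
  7≤deg x = All.lookup (toWitness {a? = all? (λ x → isVertex? x →-dec (7 ≤? deg x)) (allH 1)} _) (∈allH x)

  deg≤13 : ∀ x → IsVertex x → deg x ≤ 13
  deg≤13 x = All.lookup (toWitness {a? = all? (λ x → isVertex? x →-dec (deg x ≤? 13)) (allH 1)} _) (∈allH x)

  min-degree : IsMinDegree 1 7
  min-degree = (diagonal oneZ , nonreal⇒vertex (inj₁ (oneZ≢zeroZ 0)) , refl) , 7≤deg

  max-degree : IsMaxDegree 1 13
  max-degree = (iH , Units.iH-vertex 0 , refl) , deg≤13

theorem4p3 : ∀ (n : ℕ) → 1 ≤ n →
    ((n ≡ 1 → IsMinDegree n (2 ^ (4 * n ∸ 1) ∸ 1))
      × (1 < n → IsMinDegree n (2 ^ (4 * n ∸ 1) ∸ 2)))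
    × ((n ≡ 1 → IsMaxDegree n (2 ^ (4 * n) ∸ 3))
      × (1 < n → IsMaxDegree n (2 ^ (4 * n) ∸ 4)))
    × Girth3 n
theorem4p3 (suc zero) _ =
  ((λ _ → SmallDegrees.min-degree) , λ { (s≤s ()) }) , ((λ _ → SmallDegrees.max-degree) , λ { (s≤s ()) }) , Units.triangle 0
theorem4p3 (suc (suc k)) _ =
  ((λ ()) , λ _ → LargeDegrees.min-degree k) , ((λ ()) , λ _ → LargeDegrees.max-degree k) , Units.triangle (suc k)
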